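{- Let $\mathcal{GO}=\langle t,\prec,\phi\rangle$ be a GOMT problem with $\phi$ satisfiable, and let $A_t=\{t^{\mathcal{I}}\mid \mathcal{I}\text{ is }\mathcal{GO}\text{ -consistent}\}$. If $\prec$ is well-founded over $A_t$ and $\mathcal{GO}$ has one or more optimal solutions, then every $\mathcal{GO}$-derivation generated by a progressive derivation strategy ends with a saturated state whose interpretation component is an optimal solution of $\mathcal{GO}$.
   Context: Fix a many-sorted first-order theory $\mathcal{T}$ (a signature $\Sigma$ together with a class of $\Sigma$-interpretations, the $\mathcal{T}$-interpretations) with equality, and an infinite set of sorted variables; all interpretations considered are $\mathcal{T}$-interpretations assigning a value to every variable, and $\models$ means $\models_{\mathcal{T}}$. A GOMT problem is a triple $\mathcal{GO}=\langle t,\prec,\phi\rangle$ where $t$ is a $\Sigma$-term of some sort $\sigma$, $\prec$ is a strict partial order on the values of sort $\sigma$ definable in $\mathcal{T}$, and $\phi$ is a $\Sigma$-formula. $\mathcal{I}$ is $\mathcal{GO}$-consistent if $\mathcal{I}\models\phi$; $\mathcal{I}<_{\mathcal{GO}}\mathcal{I}'$ if both are $\mathcal{GO}$-consistent and $t^{\mathcal{I}}\prec t^{\mathcal{I}'}$; $\mathcal{I}$ is an optimal solution if it is $\mathcal{GO}$-consistent and no interpretation $\mathcal{J}$ satisfies $\mathcal{J}<_{\mathcal{GO}}\mathcal{I}$. $\textsc{Solve}$ maps a formula to an interpretation satisfying it if it is satisfiable, and to $\bot$ otherwise. $\textsc{Better}$ maps each $\mathcal{GO}$-consistent $\mathcal{I}$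 to a formula such that for every $\mathcal{GO}$-consistent $\mathcal{I}'$: $\mathcal{I}'\models\textsc{Better}(\mathcal{I})$ iff $\mathcal{I}'<_{\mathcal{GO}}\mathcal{I}$. For a finite sequence $S=(s_1,\dots,s_n)$, $\textsc{Top}(S)=s_1$, $\textsc{Pop}(S)=(s_2,\dots,s_n)$, $\emptyset$ is the empty sequence, $\circ$ is concatenation. A state is $\langle\mathcal{I},\Delta,\tau\rangle$ ($\mathcal{I}$ an interpretation, $\Delta$ a formula, $\tau$ a finite sequence of formulas). Initial state: $\mathcal{I}_0=\textsc{Solve}(\phi)$, $\Delta_0=\textsc{Better}(\mathcal{I}_0)$, $\tau_0=(\Delta_0)$. Rules (unmentioned components unchanged): F-Split: if $\tau\neq\emptyset$, $\psi=\textsc{Top}(\tau)$, $\phi\models\psi\Leftrightarrow\bigvee_{j=1}^k\psi_j$ with $k\ge1$, then $\tau:=(\psi_1,\dots,\psi_k)\circ\textsc{Pop}(\tau)$. F-Sat: if $\tau\neq\emptyset$, $\psi=\textsc{Top}(\tau)$, $\textsc{Solve}(\phi\wedge\psi)=\mathcal{I}'\neq\bot$, $\Delta'=\Delta\wedge\textsc{Better}(\mathcal{I}')$, then $\mathcal{I}:=\mathcal{I}'$, $\Delta:=\Delta'$, $\tau:=(\Delta')$. F-Close: if $\tau\neq\emptyset$, $\psi=\textsc{Top}(\tau)$, $\textsc{Solve}(\phi\wedge\psi)=\bot$, then $\Delta:=\Delta\wedge\neg\psi$, $\tau:=\textsc{Pop}(\tau)$. A rule applies if its premises hold and the resulting state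 differs; a state is saturated if no rule applies. A $\mathcal{GO}$-derivation is a sequence of states starting at the initial state, each obtained from the previous by one rule. A derivation strategy is progressive if it (i) never halts in a non-saturated state and (ii) uses F-Split only finitely many times in any derivation. -}

module Defs where

open import Data.Nat using (ℕ; zero; suc; _≤_)
open import Data.List using (List; []; _∷_; _++_; length)
open import Data.List.Relation.Unary.Any using (Any)
open import Data.Maybe using (Maybe; just; nothing)
open import Data.Product using (Σ; ∃; _×_; _,_; proj₁)
open import Relation.Nullary using (¬_)
open import Relation.Binary.PropositionalEquality using (_≡_; _≢_)
open import Relation.Binary.Structures using (IsStrictPartialOrder)
open import Induction.WellFounded using (WellFounded)
open import Function.Bundles using (_⇔_)

-- An abstract (semantic) presentation of the theory T: the T-interpretations
-- (each assigning values to all variables), the Σ-formulas, satisfaction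
-- I ⊨ f, and the formula constructors used by the calculus (∧, ¬),
-- with their standard semantics.
record Logic : Set₁ where
  infix 4 _⊨_
  infixr 6 _∧ᶠ_
  field
    Interp : Set
    Form   : Set
    _⊨_    : Interp → Form → Set
    _∧ᶠ_   : Form → Form → Form
    ¬ᶠ_    : Form → Form
    ∧-sem  : ∀ I a b → (I ⊨ (a ∧ᶠ b)) ⇔ ((I ⊨ a) × (I ⊨ b))
    ¬-sem  : ∀ I a → (I ⊨ (¬ᶠ a)) ⇔ (¬ (I ⊨ a))

-- A GOMT problem ⟨t, ≺, φ⟩: Val is the domain of the sort σ of t,
-- t is evaluated in interpretations (t^I = t I), ≺ is a strict partial order.
record GOMT (L : Logic) : Set₁ where
  open Logic L
  field
    Val   : Set
    t     : Interp → Val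
    _≺_   : Val → Val → Set
    ≺-spo : IsStrictPartialOrder _≡_ _≺_
    φ     : Form

module Problem {L : Logic} (G : GOMT L) where
  open Logic L
  open GOMT G

  Satisfiable : Form → Set
  Satisfiable f = ∃ λ I → I ⊨ f

  Consistent : Interp → Set
  Consistent I = I ⊨ φ

  infix 4 _<GO_
  _<GO_ : Interp → Interp → Set
  I <GO I' = Consistent I × Consistent I' × (t I ≺ t I')

  Optimal : Interp → Set
  Optimal I = Consistent I × (¬ (∃ λ J → J <GO I))

  A-t : Set
  A-t = Σ Val (λ v → ∃ λ I → Consistent I × t I ≡ v)

  _≺A_ : A-t → A-t → Set
  x ≺A y = proj₁ x ≺ proj₁ y

  WellFoundedOverA-t : Set
  WellFoundedOverA-t = WellFounded _≺A_

  SolveSpec : (Form → Maybe Interp) → Set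
  SolveSpec Solve =
    (∀ f I → Solve f ≡ just I → I ⊨ f) × (∀ f → Solve f ≡ nothing → ∀ I → ¬ (I ⊨ f))

  BetterSpec : (Interp → Form) → Set
  BetterSpec Better =
    ∀ I → Consistent I → ∀ I' → Consistent I' → ((I' ⊨ Better I) ⇔ (I' <GO I))

module Calculus {L : Logic} (G : GOMT L)
                (Solve : Logic.Form L → Maybe (Logic.Interp L))
                (Better : Logic.Interp L → Logic.Form L) where
  open Logic L
  open GOMT G

  record State : Set where
    constructor ⟨_,_,_⟩
    field
      interp : Interp
      Δ      : Form
      τ      : List Form

  data Rule : Set where
    F-Split F-Sat F-Close : Rule

  -- Premises + effect of each rule (the "state differs" side condition is
  -- added in Applies below).
  data Step : Rule → State → State → Set where
    f-split : ∀ {I Δ ψ τ} (ψs : List Form) → 1 ≤ length ψs →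
              (∀ J → J ⊨ φ → ((J ⊨ ψ) ⇔ Any (J ⊨_) ψs)) →
              Step F-Split ⟨ I , Δ , ψ ∷ τ ⟩ ⟨ I , Δ , ψs ++ τ ⟩
    f-sat   : ∀ {I Δ ψ τ I'} → Solve (φ ∧ᶠ ψ) ≡ just I' →
              Step F-Sat ⟨ I , Δ , ψ ∷ τ ⟩
                         ⟨ I' , Δ ∧ᶠ Better I' , (Δ ∧ᶠ Better I') ∷ [] ⟩
    f-close : ∀ {I Δ ψ τ} → Solve (φ ∧ᶠ ψ) ≡ nothing →
              Step F-Close ⟨ I , Δ , ψ ∷ τ ⟩ ⟨ I , Δ ∧ᶠ (¬ᶠ ψ) , τ ⟩

  Applies : Rule → State → State → Set
  Applies r s s' = Step r s s' × s ≢ s'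

  Saturated : State → Set
  Saturated s = ∀ r s' → ¬ Applies r s s'

  initial : Interp → State
  initial I₀ = ⟨ I₀ , Better I₀ , Better I₀ ∷ [] ⟩

  -- A (finite or infinite) GO-derivation from the initial state built on
  -- I₀ = Solve(φ): seq n = just sₙ for the states present, nothing after
  -- the derivation has halted; rule n is the rule used to go from sₙ to sₙ₊₁.
  record Derivation (I₀ : Interp) : Set where
    field
      seq   : ℕ → Maybe State
      rule  : ℕ → Rule
      start : seq 0 ≡ just (initial I₀)
      step  : ∀ n s' → seq (suc n) ≡ just s' →
              Σ State λ s → seq n ≡ just s × Applies (rule n) s s'

  record Progressive {I₀ : Interp} (D : Derivation I₀) : Set where
    open Derivation D
    field
      halts-saturated : ∀ n s → seq n ≡ just s → seq (suc n) ≡ nothing → Saturated s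
      finitely-many-splits : ∃ λ N → ∀ n → N ≤ n → ∀ s' →
                             seq (suc n) ≡ just s' → rule n ≢ F-Split

-- Every derivation preserves an invariant: all interpretations strictly better
-- than the current one satisfy Δ and some formula of τ, and every consistent
-- model of a formula of τ is strictly better than the current one.  Hence a
-- saturated state (where τ must be empty) carries an optimal solution.  Once
-- the finitely many F-Split steps are over, F-Sat strictly improves t in the
-- well-founded order on A_t and F-Close keeps the interpretation while
-- shortening τ, so the derivation cannot go on forever.
module Submission where

open import Defs
open import Data.Nat using (ℕ; zero; suc; _≤_; _<_)
open import Data.Nat.Properties using (≤-refl; m≤n⇒m≤1+n; 1+n≢n; n<1+n)
open import Data.Nat.Induction using (<-wellFounded)
open import Data.Maybe using (Maybe; just; nothing)
open import Data.Maybe.Properties using (just-injective)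
open import Data.Product using (Σ; ∃; _×_; _,_; proj₁; proj₂)
open import Data.Product.Relation.Binary.Lex.Strict using (×-Lex; ×-wellFounded')
open import Data.Sum using (inj₁; inj₂)
open import Data.Empty using (⊥-elim)
open import Data.List using ([]; _∷_; _++_; length)
open import Data.List.Relation.Unary.Any using (Any; here; there)
open import Data.List.Relation.Unary.Any.Properties using (++⁺ˡ; ++⁺ʳ; ++⁻; ¬Any[])
open import Relation.Nullary using (¬_)
open import Relation.Binary.Core using (Rel)
open import Relation.Binary.Definitions using (Transitive; _Respectsʳ_)
open import Relation.Binary.PropositionalEquality
  using (_≡_; _≢_; refl; sym; trans; cong; subst)
open import Relation.Binary.Structures using (IsStrictPartialOrder)
open import Induction.WellFounded using (WellFounded; Acc; acc)
open import Function.Bundles using (Equivalence)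

module MaybeSequence {A : Set} (f : ℕ → Maybe A) where

  Halts : Set
  Halts = Σ ℕ λ n → Σ A λ a → f n ≡ just a × f (suc n) ≡ nothing

  halts-if-undefined : ∀ {a₀ n} → f 0 ≡ just a₀ → f n ≡ nothing → Halts
  halts-if-undefined {n = zero} f0≡a₀ f0≡nothing with trans (sym f0≡a₀) f0≡nothing
  ... | ()
  halts-if-undefined {n = suc n} f0≡a₀ fn+1≡nothing with f n in fn≡
  ... | just a  = n , a , fn≡ , fn+1≡nothing
  ... | nothing = halts-if-undefined f0≡a₀ fn≡

  module _ {ℓ} {B : Set} {_<_ : Rel B ℓ} (<-wf : WellFounded _<_)
           (μ : ∀ {n a} → f n ≡ just a → B) (N : ℕ)
           (μ-decreasing : ∀ {n a a'} → N ≤ n →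
                           (e : f n ≡ just a) (e' : f (suc n) ≡ just a') → μ e' < μ e)
           where

    private
      halts-from : ∀ {n a} → N ≤ n → (e : f n ≡ just a) → Acc _<_ (μ e) → Halts
      halts-from {n} {a} N≤n e (acc rec) with f (suc n) in e'
      ... | nothing = n , a , e , e'
      ... | just a' = halts-from (m≤n⇒m≤1+n N≤n) e' (rec (μ-decreasing N≤n e e'))

    halts-if-eventually-decreasing : ∀ {a₀} → f 0 ≡ just a₀ → Halts
    halts-if-eventually-decreasing f0≡a₀ with f N in fN≡
    ... | just a  = halts-from ≤-refl fN≡ (<-wf (μ fN≡))
    ... | nothing = halts-if-undefined f0≡a₀ fN≡

module Invariants {L : Logic} (G : GOMT L)
    {Solve : Logic.Form L → Maybe (Logic.Interp L)}
    {Better : Logic.Interp L → Logic.Form L}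
    (solve-spec : Problem.SolveSpec G Solve)
    (better-spec : Problem.BetterSpec G Better) where

  open Logic L
  open GOMT G
  open Problem G
  open Calculus G Solve Better
  open State
  open Equivalence
  open IsStrictPartialOrder ≺-spo using (irrefl) renaming (trans to ≺-trans)

  record Invariant (s : State) : Set where
    field
      consistent : Consistent (interp s)
      τ-sound    : ∀ J → Consistent J → Any (J ⊨_) (τ s) → J <GO interp s
      Δ-complete : ∀ J → J <GO interp s → J ⊨ Δ s
      τ-complete : ∀ J → J <GO interp s → Any (J ⊨_) (τ s)
  open Invariant

  solution-satisfies : ∀ {f I} → Solve f ≡ just I → I ⊨ f
  solution-satisfies = proj₁ solve-spec _ _

  unsolvable-top : ∀ {ψ} → Solve (φ ∧ᶠ ψ) ≡ nothing → ∀ J → Consistent J → ¬ (J ⊨ ψ)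
  unsolvable-top {ψ} e J φJ ψJ = proj₂ solve-spec _ e J (from (∧-sem J φ ψ) (φJ , ψJ))

  solution-of-top-improves : ∀ {I Δ ψ τ I'} → Invariant ⟨ I , Δ , ψ ∷ τ ⟩ →
                             Solve (φ ∧ᶠ ψ) ≡ just I' → I' <GO I
  solution-of-top-improves {ψ = ψ} {I' = I'} inv e =
    τ-sound inv I' φI' (here ψI')
    where
    φI'∧ψI' = to (∧-sem I' φ ψ) (solution-satisfies e)
    φI' = proj₁ φI'∧ψI'
    ψI' = proj₂ φI'∧ψI'

  initial-invariant : ∀ {I₀} → Solve φ ≡ just I₀ → Invariant (initial I₀)
  initial-invariant {I₀} e = record
    { consistent = φI₀
    ; τ-sound    = λ { J φJ (here p) → to (better-spec I₀ φI₀ J φJ) p }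
    ; Δ-complete = Δ-complete′
    ; τ-complete = λ J J<I₀ → here (Δ-complete′ J J<I₀)
    }
    where
    φI₀ = solution-satisfies e
    Δ-complete′ : ∀ J → J <GO I₀ → J ⊨ Better I₀
    Δ-complete′ J J<I₀ = from (better-spec I₀ φI₀ J (proj₁ J<I₀)) J<I₀

  step-invariant : ∀ {r s s'} → Step r s s' → Invariant s → Invariant s'
  step-invariant {s = ⟨ I , Δ , ψ ∷ τ ⟩} (f-split ψs _ ψ⇔ψs) inv = record
    { consistent = consistent inv
    ; τ-sound    = τ-sound′
    ; Δ-complete = Δ-complete inv
    ; τ-complete = τ-complete′
    }
    where
    τ-sound′ : ∀ J → Consistent J → Any (J ⊨_) (ψs ++ τ) → J <GO I
    τ-sound′ J φJ J⊨ψs++τ with ++⁻ ψs J⊨ψs++τ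
    ... | inj₁ J⊨ψs = τ-sound inv J φJ (here (from (ψ⇔ψs J φJ) J⊨ψs))
    ... | inj₂ J⊨τ  = τ-sound inv J φJ (there J⊨τ)
    τ-complete′ : ∀ J → J <GO I → Any (J ⊨_) (ψs ++ τ)
    τ-complete′ J J<I with τ-complete inv J J<I
    ... | here J⊨ψ  = ++⁺ˡ (to (ψ⇔ψs J (proj₁ J<I)) J⊨ψ)
    ... | there J⊨τ = ++⁺ʳ ψs J⊨τ
  step-invariant {s = ⟨ I , Δ , ψ ∷ τ ⟩} (f-sat {I' = I'} e) inv = record
    { consistent = φI'
    ; τ-sound    = λ { J φJ (here p) →
                       to (better-spec I' φI' J φJ) (proj₂ (to (∧-sem J Δ (Better I')) p)) }
    ; Δ-complete = Δ-complete′
    ; τ-complete = λ J J<I' → here (Δ-complete′ J J<I')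
    }
    where
    I'<I = solution-of-top-improves inv e
    φI' = proj₁ I'<I
    Δ-complete′ : ∀ J → J <GO I' → J ⊨ (Δ ∧ᶠ Better I')
    Δ-complete′ J J<I'@(φJ , _ , tJ≺tI') = from (∧-sem J Δ (Better I'))
      ( Δ-complete inv J (φJ , consistent inv , ≺-trans tJ≺tI' (proj₂ (proj₂ I'<I)))
      , from (better-spec I' φI' J φJ) J<I' )
  step-invariant {s = ⟨ I , Δ , ψ ∷ τ ⟩} (f-close e) inv = record
    { consistent = consistent inv
    ; τ-sound    = λ J φJ J⊨τ → τ-sound inv J φJ (there J⊨τ)
    ; Δ-complete = λ J J<I → from (∧-sem J Δ (¬ᶠ ψ))
                     (Δ-complete inv J J<I , from (¬-sem J ψ) (unsolvable-top e J (proj₁ J<I)))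
    ; τ-complete = τ-complete′
    }
    where
    τ-complete′ : ∀ J → J <GO I → Any (J ⊨_) τ
    τ-complete′ J J<I with τ-complete inv J J<I
    ... | here J⊨ψ  = ⊥-elim (unsolvable-top e J (proj₁ J<I) J⊨ψ)
    ... | there J⊨τ = J⊨τ

  saturated-τ-empty : ∀ {s} → Invariant s → Saturated s → τ s ≡ []
  saturated-τ-empty {⟨ I , Δ , [] ⟩} inv sat = refl
  saturated-τ-empty {⟨ I , Δ , ψ ∷ τ ⟩} inv sat with Solve (φ ∧ᶠ ψ) in e
  ... | just I' = ⊥-elim (sat F-Sat _ (f-sat e , interp-changes))
    where
    interp-changes : ⟨ I , Δ , ψ ∷ τ ⟩ ≢ ⟨ I' , Δ ∧ᶠ Better I' , (Δ ∧ᶠ Better I') ∷ [] ⟩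
    interp-changes s≡s' with cong interp s≡s'
    ... | refl = irrefl refl (proj₂ (proj₂ (solution-of-top-improves inv e)))
  ... | nothing = ⊥-elim (sat F-Close _ (f-close e , τ-shrinks))
    where
    τ-shrinks : ⟨ I , Δ , ψ ∷ τ ⟩ ≢ ⟨ I , Δ ∧ᶠ (¬ᶠ ψ) , τ ⟩
    τ-shrinks s≡s' = 1+n≢n (cong (λ s → length (State.τ s)) s≡s')

  saturated-optimal : ∀ {s} → Invariant s → Saturated s → Optimal (interp s)
  saturated-optimal {s} inv sat = consistent inv , no-better
    where
    no-better : ¬ (∃ λ J → J <GO interp s)
    no-better (J , J<I) =
      ¬Any[] (subst (Any (J ⊨_)) (saturated-τ-empty inv sat) (τ-complete inv J J<I))

  _≈ᵥ_ : Rel A-t _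
  x ≈ᵥ y = proj₁ x ≡ proj₁ y

  _⊏_ : Rel (A-t × ℕ) _
  _⊏_ = ×-Lex _≈ᵥ_ _≺A_ _<_

  ⊏-wellFounded : WellFoundedOverA-t → WellFounded _⊏_
  -- The implicit arguments are passed explicitly because _≈ᵥ_ only mentions
  -- proj₁ of its arguments, from which they cannot be inferred.
  ⊏-wellFounded wf = ×-wellFounded' (λ {x y z} → ≈ᵥ-trans {x} {y} {z})
                                    (λ {z x y} → ≺A-respʳ-≈ᵥ {z} {x} {y}) wf <-wellFounded
    where
    ≈ᵥ-trans : Transitive _≈ᵥ_
    ≈ᵥ-trans = trans
    ≺A-respʳ-≈ᵥ : _≺A_ Respectsʳ _≈ᵥ_
    ≺A-respʳ-≈ᵥ {z} x≈y z≺x = subst (proj₁ z ≺_) x≈y z≺x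

  measure : ∀ s → Consistent (interp s) → A-t × ℕ
  measure s φs = (t (interp s) , interp s , φs , refl) , length (τ s)

  non-split-step-decreases : ∀ {r s s'} → Step r s s' → r ≢ F-Split → Invariant s →
                    (φs : Consistent (interp s)) (φs' : Consistent (interp s')) →
                    measure s' φs' ⊏ measure s φs
  non-split-step-decreases (f-split _ _ _) no-split = ⊥-elim (no-split refl)
  non-split-step-decreases (f-sat e) _ inv _ _ = inj₁ (proj₂ (proj₂ (solution-of-top-improves inv e)))
  non-split-step-decreases {s = ⟨ _ , _ , _ ∷ τ ⟩} (f-close _) _ _ _ _ = inj₂ (refl , n<1+n (length τ))

module Reachability {L : Logic} (G : GOMT L)
    {Solve : Logic.Form L → Maybe (Logic.Interp L)}
    {Better : Logic.Interp L → Logic.Form L}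
    (solve-spec : Problem.SolveSpec G Solve)
    (better-spec : Problem.BetterSpec G Better)
    {I₀ : Logic.Interp L} (solve-φ : Solve (GOMT.φ G) ≡ just I₀)
    (D : Calculus.Derivation G Solve Better I₀) where

  open Calculus G Solve Better
  open Derivation D
  open Invariants G solve-spec better-spec

  applied-step : ∀ {n s s'} → seq n ≡ just s → seq (suc n) ≡ just s' → Step (rule n) s s'
  applied-step {n} {s' = s'} seq-n seq-n+1 with step n s' seq-n+1
  ... | _ , seq-n′ , st , _ with just-injective (trans (sym seq-n) seq-n′)
  ... | refl = st

  reachable-invariant : ∀ {n s} → seq n ≡ just s → Invariant s
  reachable-invariant {zero} seq-0 with just-injective (trans (sym start) seq-0)
  ... | refl = initial-invariant solve-φ
  reachable-invariant {suc n} {s'} seq-n+1 with step n s' seq-n+1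
  ... | _ , seq-n , st , _ = step-invariant st (reachable-invariant seq-n)

  derivation-halts : Problem.WellFoundedOverA-t G → Progressive D → MaybeSequence.Halts seq
  derivation-halts wf progressive =
    halts-if-eventually-decreasing (⊏-wellFounded wf) μ N μ-decreasing start
    where
    open Progressive progressive
    open MaybeSequence seq
    μ : ∀ {n s} → seq n ≡ just s → Problem.A-t G × ℕ
    μ {s = s} seq-n = measure s (Invariant.consistent (reachable-invariant seq-n))
    N = proj₁ finitely-many-splits
    μ-decreasing : ∀ {n s s'} → N ≤ n → (e : seq n ≡ just s) (e' : seq (suc n) ≡ just s') →
                   μ e' ⊏ μ e
    μ-decreasing N≤n e e' = non-split-step-decreases (applied-step e e')
      (proj₂ finitely-many-splits _ N≤n _ e') (reachable-invariant e)
      (Invariant.consistent (reachable-invariant e)) (Invariant.consistent (reachable-invariant e'))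

theorem3 : (L : Logic) (G : GOMT L)
    (Solve : Logic.Form L → Maybe (Logic.Interp L))
    (Better : Logic.Interp L → Logic.Form L) →
    Problem.SolveSpec G Solve →
    Problem.BetterSpec G Better →
    Problem.Satisfiable G (GOMT.φ G) →
    Problem.WellFoundedOverA-t G →
    (∃ λ I → Problem.Optimal G I) →
    (I₀ : Logic.Interp L) → Solve (GOMT.φ G) ≡ just I₀ →
    (D : Calculus.Derivation G Solve Better I₀) →
    Calculus.Progressive G Solve Better D →
    Σ ℕ λ n → Σ (Calculus.State G Solve Better) λ s →
    Calculus.Derivation.seq D n ≡ just s ×
    Calculus.Derivation.seq D (suc n) ≡ nothing ×
    Calculus.Saturated G Solve Better s ×
    Problem.Optimal G (Calculus.State.interp s)
theorem3 L G Solve Better solve-spec better-spec _ wf _ I₀ solve-φ D progressive =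
  let (n , s , seq-n , seq-n+1) = derivation-halts wf progressive
      saturated = halts-saturated n s seq-n seq-n+1
  in n , s , seq-n , seq-n+1 , saturated , saturated-optimal (reachable-invariant seq-n) saturated
  where
  open Calculus.Progressive progressive
  open Invariants G solve-spec better-spec
  open Reachability G solve-spec better-spec solve-φ D
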